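{- Any table obtained from the initial table by successive calls to the procedure $\mathrm{make}$ does not contain two nodes $q\neq q'$ with $L(q)=L(q')$.
   Context: Fix an alphabet $\Sigma=\{a_1,\dots,a_m\}$. A table is a finite set of nodes $q:(s,b)$, where $q$ is an identifier (identifiers are natural numbers, totally ordered), $s=(q_1,\dots,q_m)$ is the successor tuple, each $q_i$ being either the special symbol $\mathrm{self}$ or the identifier of a node already in the table, and $b\in\{0,1\}$ is the acceptance flag. Write $q^{a_i}:=q_i$. For a tuple $s$ and flag $b$, the language $L(s,b)\subseteq\Sigma^*$ (and $L(q):=L(s,b)$ for a node $q:(s,b)$) is defined recursively: the empty word belongs to it iff $b=1$; and $a_iw$ belongs to it iff either $q_i=\mathrm{self}$ and $w\in L(s,b)$, or $q_i\neq\mathrm{self}$ and $w\in L(q_i)$. The initial table contains exactly the two nodes $q_\emptyset:((\mathrm{self},\dots,\mathrm{self}),0)$ and $q_{\mathrm{all}}:((\mathrm{self},\dots,\mathrm{self}),1)$ with the two smallest identifiers (their languages are $\emptyset$ and $\Sigma^*$). The procedure $\mathrm{make}(s,b)$, where $s$ is a tuple whose entries are $\mathrm{self}$ or identifiers in the table and $b\in\{0,1\}$, works as follows: (1) if the table contains a node $q:(s,b)$, return $q$; (2) otherwise let $q'$ be the largest identifier occurring in $s$ and let $s'$ be obtained from $s$ by replacing every occurrence of $q'$ by $\mathrm{self}$; if the table contains a node $q:(s',b)$, return $q$; (3) otherwise add a node $q:(s,b)$ with a fresh identifier $q$ larger than all existing identifiers, and return $q$. -}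

module Defs where

open import Data.Nat using (ℕ; zero; suc; _<_; _⊔_)
open import Data.Nat as ℕ using ()
open import Data.Bool using (Bool; true; false)
open import Data.Fin using (Fin)
open import Data.Vec using (Vec; replicate; lookup; map; foldr)
open import Data.List using (List; []; _∷_)
open import Data.List.Membership.Propositional using (_∈_)
open import Data.List.Relation.Unary.All using (All)
open import Data.Maybe using (Maybe; just; nothing)
open import Data.Product using (_×_; _,_; proj₁)
open import Relation.Binary.PropositionalEquality using (_≡_)
open import Relation.Nullary using (¬_; yes; no)

module _ (m : ℕ) where

  data Succ : Set where
    self : Succ
    node : ℕ → Succ

  Tuple : Set
  Tuple = Vec Succ m

  -- a node q:(s,b) is the triple (q , s , b)
  Node : Set
  Node = ℕ × Tuple × Bool

  Table : Set
  Table = List Node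

  ident : Node → ℕ
  ident = proj₁

  -- words over Σ = {a_1,...,a_m}; letter a_i is represented by i : Fin m
  Word : Set
  Word = List (Fin m)

  -- w ∈ L(s,b), relative to table T (inductive form of the recursive definition)
  data InL (T : Table) (s : Tuple) (b : Bool) : Word → Set where
    nil      : b ≡ true → InL T s b []
    viaSelf  : ∀ {i w} → lookup s i ≡ self → InL T s b w → InL T s b (i ∷ w)
    viaNode  : ∀ {i w q s' b'} → lookup s i ≡ node q → (q , s' , b') ∈ T →
               InL T s' b' w → InL T s b (i ∷ w)

  L : Table → Node → Word → Set
  L T (_ , s , b) w = InL T s b w

  SameL : Table → Node → Node → Set
  SameL T n n' = ∀ w → (L T n w → L T n' w) × (L T n' w → L T n w)

  -- the initial table: q_∅ = 0 and q_all = 1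
  initTable : Table
  initTable = (0 , replicate m self , false) ∷ (1 , replicate m self , true) ∷ []

  maxSucc : Succ → Maybe ℕ → Maybe ℕ
  maxSucc self     r        = r
  maxSucc (node q) nothing  = just q
  maxSucc (node q) (just r) = just (q ⊔ r)

  maxId : Tuple → Maybe ℕ
  maxId s = foldr _ maxSucc nothing s

  replaceBySelf : ℕ → Succ → Succ
  replaceBySelf q' self = self
  replaceBySelf q' (node q) with q ℕ.≟ q'
  ... | yes _ = self
  ... | no  _ = node q

  -- s' of step (2); if s contains no identifier there is nothing to replace
  reduce : Tuple → Tuple
  reduce s with maxId s
  ... | nothing = s
  ... | just q' = map (replaceBySelf q') s

  ValidTuple : Table → Tuple → Set
  ValidTuple T s = ∀ i q → lookup s i ≡ node q → Data.Product.∃ λ n → n ∈ T × ident n ≡ q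

  NoNode : Table → Tuple → Bool → Set
  NoNode T s b = ∀ q → ¬ ((q , s , b) ∈ T)

  -- Make T s b T' q : the call make(s,b) on table T may return q, leaving table T'
  data Make (T : Table) (s : Tuple) (b : Bool) : Table → ℕ → Set where
    step1 : ∀ {q} → (q , s , b) ∈ T → Make T s b T q
    step2 : ∀ {q} → NoNode T s b → (q , reduce s , b) ∈ T → Make T s b T q
    step3 : ∀ {q} → NoNode T s b → NoNode T (reduce s) b →
            All (λ n → ident n < q) T → Make T s b ((q , s , b) ∷ T) q

  data Reachable : Table → Set where
    init : Reachable initTable
    call : ∀ {T T' s b q} → Reachable T → ValidTuple T s → Make T s b T' q → Reachable T'

{-# OPTIONS --safe #-}
-- Reachable tables are well formed: identifiers are unique, every successor is a node with a
-- smaller identifier, and distinct nodes have distinct languages.  Only step (3) changes the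
-- table, and a fresh identifier changes no existing language.  Suppose the new node (s,b) had
-- the language of an old node p:(s',b').  Comparing the derivatives L(s,b)_{a_i} and
-- L(s',b')_{a_i} entry by entry, minimality forces s and s' to agree, except where s' has self
-- and s refers to a node r with L(r) = L(s,b) (the converse mismatch would give p a successor
-- with its own language, impossible as successors are smaller).  With no such entry s' = s and
-- step (1) would have applied.  Otherwise r = p by minimality, so p is the largest identifier in
-- s and s' is s with p replaced by self: step (2) would have applied.
module Submission where

open import Defs
open import Data.Nat using (ℕ; _<_; _≤_)
open import Data.Nat.Properties using (<-irrefl; <⇒≢; <⇒≤; ≤-refl; ⊔-lub; m≥n⇒m⊔n≡m; m≤n⇒m⊔n≡n)
open import Data.Nat as ℕ using ()
open import Data.Bool using (Bool; true; false)
open import Data.Fin using (Fin)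
open import Data.Vec using (Vec; _∷_; lookup; map; replicate; foldr)
open import Data.Vec.Properties using (lookup-map; lookup-replicate)
open import Data.Vec.Relation.Unary.All as VAll using ([]; _∷_)
open import Data.Vec.Relation.Unary.All.Properties using (lookup⁻)
open import Data.Vec.Relation.Unary.Any using (here; there)
open import Data.Vec.Relation.Binary.Pointwise.Extensional using (ext; Pointwise-≡⇒≡)
open import Data.Vec.Membership.Propositional as Vec using ()
open import Data.Vec.Membership.Propositional.Properties using (∈-lookup)
open import Data.List using ([]; _∷_)
open import Data.List.Membership.Propositional using (_∈_)
open import Data.List.Relation.Unary.Any using (here; there)
open import Data.List.Relation.Unary.All as All using (All)
open import Data.Maybe using (Maybe; just; nothing)
open import Data.Maybe.Relation.Unary.All as MAll using (just; nothing)
open import Data.Product using (∃; ∃₂; _×_; _,_; proj₁; proj₂)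
open import Data.Sum using (_⊎_; inj₁; inj₂)
open import Data.Empty using (⊥-elim)
open import Level using (0ℓ)
open import Relation.Unary using (Pred; _⊆_; _≐_)
open import Relation.Unary.Properties using (≐-sym; ≐-trans)
open import Relation.Binary.PropositionalEquality
open import Function using (_∘_)
open import Relation.Nullary using (¬_; yes; no)

module _ {m : ℕ} where

  infixr 5 _⟫_
  _⟫_ : {P Q R : Pred (Word m) 0ℓ} → P ≐ Q → Q ≐ R → P ≐ R
  _⟫_ = ≐-trans

  data _≼_ : Succ m → ℕ → Set where
    self≼ : ∀ {r} → self ≼ r
    node≼ : ∀ {v r} → v ≤ r → node v ≼ r

  maxId′ : ∀ {n} → Vec (Succ m) n → Maybe ℕ
  maxId′ = foldr (λ _ → Maybe ℕ) (maxSucc m) nothing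

  maxSucc-≤ : ∀ {x o r} → x ≼ r → MAll.All (_≤ r) o → MAll.All (_≤ r) (maxSucc m x o)
  maxSucc-≤ self≼      o≤r        = o≤r
  maxSucc-≤ (node≼ v≤r) nothing   = just v≤r
  maxSucc-≤ (node≼ v≤r) (just z≤r) = just (⊔-lub v≤r z≤r)

  maxId-≤ : ∀ {n r} {xs : Vec (Succ m) n} → VAll.All (_≼ r) xs → MAll.All (_≤ r) (maxId′ xs)
  maxId-≤ []           = nothing
  maxId-≤ (x≼r ∷ xs≼r) = maxSucc-≤ x≼r (maxId-≤ xs≼r)

  maxId-attained : ∀ {n r} {xs : Vec (Succ m) n} → VAll.All (_≼ r) xs → node r Vec.∈ xs →
                   maxId′ xs ≡ just r
  maxId-attained {xs = _ ∷ xs} (_ ∷ xs≼r) (here refl) with maxId′ xs | maxId-≤ xs≼r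
  ... | nothing | nothing  = refl
  ... | just _  | just z≤r = cong just (m≥n⇒m⊔n≡m z≤r)
  maxId-attained {r = r} (x≼r ∷ xs≼r) (there r∈xs) rewrite maxId-attained xs≼r r∈xs = absorb x≼r
    where
    absorb : ∀ {x} → x ≼ r → maxSucc m x (just r) ≡ just r
    absorb self≼       = refl
    absorb (node≼ v≤r) = cong just (m≤n⇒m⊔n≡n v≤r)

  reduce-just : ∀ {s r} → maxId m s ≡ just r → reduce m s ≡ map (replaceBySelf m r) s
  reduce-just {s} e with maxId m s | e
  ... | just _ | refl = refl

  data ReductOf (r : ℕ) : Succ m → Succ m → Set where
    same-self : ReductOf r self self
    unfold    : ReductOf r self (node r)
    same-node : ∀ {u} → u < r → ReductOf r (node u) (node u)

  reductOf-≼ : ∀ {r x y} → ReductOf r x y → y ≼ r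
  reductOf-≼ same-self       = self≼
  reductOf-≼ unfold          = node≼ ≤-refl
  reductOf-≼ (same-node u<r) = node≼ (<⇒≤ u<r)

  replaceBySelf-reductOf : ∀ {r x y} → ReductOf r x y → replaceBySelf m r y ≡ x
  replaceBySelf-reductOf same-self = refl
  replaceBySelf-reductOf {r} unfold with r ℕ.≟ r
  ... | yes _   = refl
  ... | no  r≢r = ⊥-elim (r≢r refl)
  replaceBySelf-reductOf {r} (same-node {u} u<r) with u ℕ.≟ r
  ... | yes u≡r = ⊥-elim (<⇒≢ u<r u≡r)
  ... | no  _   = refl

  reduce-reductOf : ∀ {r} {s′ : Tuple m} s j → lookup s j ≡ node r →
                    (∀ i → ReductOf r (lookup s′ i) (lookup s i)) → reduce m s ≡ s′
  reduce-reductOf {r} {s′} s j sj≡r red = begin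
    reduce m s                    ≡⟨ reduce-just (maxId-attained s≼r r∈s) ⟩
    map (replaceBySelf m r) s     ≡⟨ Pointwise-≡⇒≡ (ext replaced) ⟩
    s′                            ∎
    where
    open ≡-Reasoning
    s≼r : VAll.All (_≼ r) s
    s≼r = lookup⁻ (λ i → reductOf-≼ (red i))
    r∈s : node r Vec.∈ s
    r∈s = subst (Vec._∈ s) sj≡r (∈-lookup j s)
    replaced : ∀ i → lookup (map (replaceBySelf m r) s) i ≡ lookup s′ i
    replaced i = trans (lookup-map i _ s) (replaceBySelf-reductOf (red i))

  derivative : Fin m → Pred (Word m) 0ℓ → Pred (Word m) 0ℓ
  derivative i P w = P (i ∷ w)

  derivative-cong : ∀ {P Q} i → P ≐ Q → derivative i P ≐ derivative i Q
  derivative-cong i (P⊆Q , Q⊆P) = P⊆Q , Q⊆P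

  UniqueIds : Table m → Set
  UniqueIds T = ∀ {n n′} → n ∈ T → n′ ∈ T → ident m n ≡ ident m n′ → n ≡ n′

  Closed : Table m → Set
  Closed T = ∀ {p s b} → (p , s , b) ∈ T → ValidTuple m T s

  module _ {T : Table m} {b : Bool} (s : Tuple m) (i : Fin m) where

    derivative-self : lookup s i ≡ self → derivative i (InL m T s b) ≐ InL m T s b
    derivative-self si≡self = strip , viaSelf si≡self
      where
      strip : derivative i (InL m T s b) ⊆ InL m T s b
      strip (viaSelf _ w∈L)       = w∈L
      strip (viaNode si≡node _ _) with trans (sym si≡self) si≡node
      ... | ()

    derivative-node : ∀ {u su bu} → UniqueIds T → lookup s i ≡ node u → (u , su , bu) ∈ T →
                      derivative i (InL m T s b) ≐ InL m T su bu
    derivative-node {su = su} {bu} ids si≡u u∈T = strip , viaNode si≡u u∈T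
      where
      strip : derivative i (InL m T s b) ⊆ InL m T su bu
      strip (viaSelf si≡self _) with trans (sym si≡self) si≡u
      ... | ()
      strip (viaNode si≡u′ u′∈T w∈L) with trans (sym si≡u′) si≡u
      ... | refl with ids u′∈T u∈T refl
      ...   | refl = w∈L

  accepts-ε : ∀ {T s b} → InL m T s b [] → b ≡ true
  accepts-ε (nil b≡true) = b≡true

  ≐⇒flag-≡ : ∀ {T s b s′ b′} → InL m T s b ≐ InL m T s′ b′ → b ≡ b′
  ≐⇒flag-≡ {b = false} {b′ = false} _         = refl
  ≐⇒flag-≡ {b = true}  {b′ = true}  _         = refl
  ≐⇒flag-≡ {b = false} {b′ = true}  (_ , L′⊆L) = accepts-ε (L′⊆L (nil refl))
  ≐⇒flag-≡ {b = true}  {b′ = false} (L⊆L′ , _) = sym (accepts-ε (L⊆L′ (nil refl)))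

  referent : ∀ {T u} → (∃ λ n → n ∈ T × ident m n ≡ u) → ∃₂ λ su bu → (u , su , bu) ∈ T
  referent ((_ , su , bu) , u∈T , refl) = su , bu , u∈T

  module Extension {T : Table m} {q : ℕ} {s₀ : Tuple m} {b₀ : Bool}
    (closed : Closed T) (fresh : All (λ n → ident m n ≢ q) T) where

    T′ : Table m
    T′ = (q , s₀ , b₀) ∷ T

    weaken-valid : ∀ s → ValidTuple m T s → ValidTuple m T′ s
    weaken-valid _ valid i u si≡u with valid i u si≡u
    ... | n , n∈T , n≡u = n , there n∈T , n≡u

    extend : ∀ {s b} → InL m T s b ⊆ InL m T′ s b
    extend (nil b≡true)            = nil b≡true
    extend (viaSelf si≡self w∈L)   = viaSelf si≡self (extend w∈L)
    extend (viaNode si≡u u∈T w∈L)  = viaNode si≡u (there u∈T) (extend w∈L)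

    restrict : ∀ {s b} → ValidTuple m T s → InL m T′ s b ⊆ InL m T s b
    restrict valid (nil b≡true)                   = nil b≡true
    restrict valid (viaSelf si≡self w∈L)          = viaSelf si≡self (restrict valid w∈L)
    restrict valid (viaNode si≡u (there u∈T) w∈L) = viaNode si≡u u∈T (restrict (closed u∈T) w∈L)
    restrict valid (viaNode {i} si≡q (here refl) _) with valid i q si≡q
    ... | n , n∈T , n≡q = ⊥-elim (All.lookup fresh n∈T n≡q)

    extension-≐ : ∀ {s b} → ValidTuple m T s → InL m T′ s b ≐ InL m T s b
    extension-≐ valid = restrict valid , extend

    restrict-≐ : ∀ {s b s′ b′} → ValidTuple m T s → ValidTuple m T s′ →
                 InL m T′ s b ≐ InL m T′ s′ b′ → InL m T s b ≐ InL m T s′ b′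
    restrict-≐ valid valid′ E = ≐-sym (extension-≐ valid) ⟫ E ⟫ extension-≐ valid′

  record WellFormed (T : Table m) : Set where
    field
      ids-unique  : UniqueIds T
      closed      : Closed T
      successor-< : ∀ {p s b} → (p , s , b) ∈ T → ∀ i u → lookup s i ≡ node u → u < p
      minimal     : ∀ {n n′} → n ∈ T → n′ ∈ T → L m T n ≐ L m T n′ → n ≡ n′

  Redundant : Table m → Tuple m → Bool → Fin m → Set
  Redundant T s b i = ∃ λ n → n ∈ T × lookup s i ≡ node (ident m n) × L m T n ≐ InL m T s b

  module _ {T : Table m} (wf : WellFormed T) where
    open WellFormed wf

    irredundant : ∀ {p s b} → (p , s , b) ∈ T → ∀ i → ¬ Redundant T s b i
    irredundant p∈T i (u , u∈T , si≡u , E) with minimal u∈T p∈T E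
    ... | refl = <-irrefl refl (successor-< p∈T i _ si≡u)

    entries-match : ∀ {p sp bp s b} → (p , sp , bp) ∈ T → ValidTuple m T s →
                    InL m T sp bp ≐ InL m T s b →
                    ∀ i → lookup sp i ≡ lookup s i ⊎ (lookup sp i ≡ self × Redundant T s b i)
    entries-match {sp = sp} {s = s} p∈T valid E i with lookup sp i in spi | lookup s i in si
    ... | self   | self   = inj₁ refl
    ... | self   | node t with referent (valid i t si)
    ...   | st , bt , t∈T = inj₂ (refl , (t , st , bt) , t∈T , refl ,
            ≐-sym (derivative-node s i ids-unique si t∈T)
              ⟫ derivative-cong i (≐-sym E) ⟫ derivative-self sp i spi ⟫ E)
    entries-match {sp = sp} {s = s} p∈T valid E i | node u | self with referent (closed p∈T i u spi)
    ...   | su , bu , u∈T = ⊥-elim (irredundant p∈T i ((u , su , bu) , u∈T , spi ,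
            ≐-sym (derivative-node sp i ids-unique spi u∈T)
              ⟫ derivative-cong i E ⟫ derivative-self s i si ⟫ ≐-sym E))
    entries-match {sp = sp} {s = s} p∈T valid E i | node u | node t
      with referent (closed p∈T i u spi) | referent (valid i t si)
    ...   | su , bu , u∈T | st , bt , t∈T = inj₁ (cong (node ∘ ident m) (minimal u∈T t∈T
            (≐-sym (derivative-node sp i ids-unique spi u∈T)
              ⟫ derivative-cong i E ⟫ derivative-node s i ids-unique si t∈T)))

    same-language⇒present : ∀ {p sp bp s b} → (∀ i → ¬ Redundant T s b i) → ValidTuple m T s →
                            (p , sp , bp) ∈ T → InL m T sp bp ≐ InL m T s b → (p , s , b) ∈ T
    same-language⇒present {p} {sp} {bp} {s} {b} irred valid p∈T E =
      subst₂ (λ s′ b′ → (p , s′ , b′) ∈ T) sp≡s (≐⇒flag-≡ E) p∈T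
      where
      same-entry : ∀ i → lookup sp i ≡ lookup s i
      same-entry i with entries-match p∈T valid E i
      ... | inj₁ eq        = eq
      ... | inj₂ (_ , red) = ⊥-elim (irred i red)
      sp≡s : sp ≡ s
      sp≡s = Pointwise-≡⇒≡ (ext same-entry)

    redundant⇒reduct-present : ∀ {s b j} → ValidTuple m T s → Redundant T s b j →
                               ∃ λ r → (r , reduce m s , b) ∈ T
    redundant⇒reduct-present {s} {b} {j} valid ((r , sr , br) , r∈T , sj≡r , E) =
      r , subst₂ (λ s′ b′ → (r , s′ , b′) ∈ T)
                 (sym (reduce-reductOf s j sj≡r reduct)) (≐⇒flag-≡ E) r∈T
      where
      unchanged : ∀ x → (∀ u → x ≡ node u → u < r) → ReductOf r x x
      unchanged self     _   = same-self
      unchanged (node u) u<r = same-node (u<r u refl)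
      reduct : ∀ i → ReductOf r (lookup sr i) (lookup s i)
      reduct i with entries-match r∈T valid E i
      ... | inj₁ eq rewrite sym eq = unchanged (lookup sr i) (successor-< r∈T i)
      ... | inj₂ (sri≡self , t , t∈T , si≡t , E′) with minimal t∈T r∈T (E′ ⟫ ≐-sym E)
      ...   | refl = subst₂ (ReductOf r) (sym sri≡self) (sym si≡t) unfold

    new-language : ∀ {s b p sp bp} → ValidTuple m T s → NoNode m T s b →
                   NoNode m T (reduce m s) b → (p , sp , bp) ∈ T → ¬ (InL m T sp bp ≐ InL m T s b)
    new-language valid no-s no-reduct p∈T E = no-s _ (same-language⇒present irred valid p∈T E)
      where
      irred : ∀ i → ¬ Redundant T _ _ i
      irred i red = no-reduct _ (proj₂ (redundant⇒reduct-present valid red))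

  step3-preserves : ∀ {T s b q} → WellFormed T → ValidTuple m T s → NoNode m T s b →
                    NoNode m T (reduce m s) b → All (λ n → ident m n < q) T →
                    WellFormed ((q , s , b) ∷ T)
  step3-preserves {T} {s} {b} {q} wf valid no-s no-reduct below = record
    { ids-unique  = ids-unique′
    ; closed      = closed′
    ; successor-< = successor-<′
    ; minimal     = minimal′
    }
    where
    open WellFormed wf
    open Extension {T} {q} {s} {b} closed (All.map <⇒≢ below)
    ids-unique′ : UniqueIds T′
    ids-unique′ (here refl)  (here refl)  _    = refl
    ids-unique′ (here refl)  (there n′∈T) q≡n′ = ⊥-elim (<⇒≢ (All.lookup below n′∈T) (sym q≡n′))
    ids-unique′ (there n∈T)  (here refl)  n≡q  = ⊥-elim (<⇒≢ (All.lookup below n∈T) n≡q)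
    ids-unique′ (there n∈T)  (there n′∈T) n≡n′ = ids-unique n∈T n′∈T n≡n′
    closed′ : Closed T′
    closed′ (here refl)           = weaken-valid s valid
    closed′ {s = s′} (there p∈T) = weaken-valid s′ (closed p∈T)
    successor-<′ : ∀ {p s b} → (p , s , b) ∈ T′ → ∀ i u → lookup s i ≡ node u → u < p
    successor-<′ (here refl) i u si≡u with valid i u si≡u
    ... | _ , n∈T , refl = All.lookup below n∈T
    successor-<′ (there p∈T) = successor-< p∈T
    minimal′ : ∀ {n n′} → n ∈ T′ → n′ ∈ T′ → L m T′ n ≐ L m T′ n′ → n ≡ n′
    minimal′ (here refl) (here refl)  _ = refl
    minimal′ (here refl) (there n′∈T) E =
      ⊥-elim (new-language wf valid no-s no-reduct n′∈T (≐-sym (restrict-≐ valid (closed n′∈T) E)))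
    minimal′ (there n∈T) (here refl)  E =
      ⊥-elim (new-language wf valid no-s no-reduct n∈T (restrict-≐ (closed n∈T) valid E))
    minimal′ (there n∈T) (there n′∈T) E =
      minimal n∈T n′∈T (restrict-≐ (closed n∈T) (closed n′∈T) E)

  initTable-wellFormed : WellFormed (initTable m)
  initTable-wellFormed = record
    { ids-unique  = ids-unique′
    ; closed      = closed′
    ; successor-< = successor-<′
    ; minimal     = minimal′
    }
    where
    no-successor : ∀ i {u} → ¬ (lookup (replicate m self) i ≡ node u)
    no-successor i e with trans (sym (lookup-replicate i self)) e
    ... | ()
    closed′ : Closed (initTable m)
    closed′ (here refl)         i _ e = ⊥-elim (no-successor i e)
    closed′ (there (here refl)) i _ e = ⊥-elim (no-successor i e)
    successor-<′ : ∀ {p s b} → (p , s , b) ∈ initTable m → ∀ i u → lookup s i ≡ node u → u < p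
    successor-<′ (here refl)         i _ e = ⊥-elim (no-successor i e)
    successor-<′ (there (here refl)) i _ e = ⊥-elim (no-successor i e)
    ids-unique′ : UniqueIds (initTable m)
    ids-unique′ (here refl)         (here refl)         _  = refl
    ids-unique′ (there (here refl)) (there (here refl)) _  = refl
    ids-unique′ (here refl)         (there (here refl)) ()
    ids-unique′ (there (here refl)) (here refl)         ()
    minimal′ : ∀ {n n′} → n ∈ initTable m → n′ ∈ initTable m →
               L m (initTable m) n ≐ L m (initTable m) n′ → n ≡ n′
    minimal′ (here refl)         (here refl)         _ = refl
    minimal′ (there (here refl)) (there (here refl)) _ = refl
    minimal′ (here refl)         (there (here refl)) E with ≐⇒flag-≡ E
    ... | ()
    minimal′ (there (here refl)) (here refl)         E with ≐⇒flag-≡ E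
    ... | ()

  reachable⇒wellFormed : ∀ {T} → Reachable m T → WellFormed T
  reachable⇒wellFormed init                                         = initTable-wellFormed
  reachable⇒wellFormed (call R _     (step1 _))                     = reachable⇒wellFormed R
  reachable⇒wellFormed (call R _     (step2 _ _))                   = reachable⇒wellFormed R
  reachable⇒wellFormed (call R valid (step3 no-s no-reduct below)) =
    step3-preserves (reachable⇒wellFormed R) valid no-s no-reduct below

proposition6 : (m : ℕ) (T : Table m) → Reachable m T →
    (n n' : Node m) → n ∈ T → n' ∈ T → ident m n ≢ ident m n' →
    ¬ SameL m T n n'
proposition6 m T R n n' n∈T n'∈T n≢n' same =
  n≢n' (cong (ident m) (WellFormed.minimal (reachable⇒wellFormed R) n∈T n'∈T L≐L′))
  where
  L≐L′ : L m T n ≐ L m T n'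
  L≐L′ = (λ {w} → proj₁ (same w)) , (λ {w} → proj₂ (same w))
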